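{- Let $G$ be a strongly connected signed digraph on vertex set $V$ all of whose cycles are positive. Then $G$ is robustly trapping: for every nonempty set $\mathcal F$ of BNs on $V$ such that $G(f)$ is a spanning subgraph of $G$ for all $f\in\mathcal F$, the union $\bigcup_{f\in\mathcal F}\Gamma(f)$ is trapping.
   Context: A signed digraph $G=(V,E)$ has finite vertex set $V$ and arcs $E\subseteq V\times V\times\{ -1,1\}$ ($(j,i,s)$: arc from $j$ to $i$ of sign $s$). Cycles are simple; sign = product of arc signs; strong connectivity refers to the underlying digraph. A spanning subgraph of $G$ is $(V,E')$ with $E'\subseteq E$. A BN on $V$ is $f:\{0,1\}^V\to\{0,1\}^V$; $G(f)$ has a positive (negative) arc from $j$ to $i$ iff for some $x$ with $x_j=0$, $f_i(x+e_j)-f_i(x)$ is positive (negative) ($e_j$ = configuration equal to $1$ only at $j$, $+$ mod 2). $\Gamma(f)$ is the digraph on $\{0,1\}^V$ with arcs $x\to x+e_i$ whenever $f_i(x)\neq x_i$; unions of such digraphs take the union of arc sets. For a digraph $\Gamma$ on $\{0,1\}^V$: a trap set has no outgoing arc; an attractor is an inclusion-minimal nonempty trap set; a subspace is $\{x:x_i=c(i)\ \forall i\in I\}$; $[X]$ the smallest subspace containing $X$; a trap space is a subspace that is a trap set; $\langle X\rangle$ the smallest trap space containing $X$. $\Gamma$ is trapping if $[A]\cap[B]=\emptyset$ for distinct attractors $A,B$ and $[A]=\langle A\rangle$ for every attractor $A$. -}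

module Defs where

open import Level using (0ℓ)
open import Data.Nat using (ℕ; suc)
open import Data.Fin using (Fin; zero; suc; inject₁; fromℕ)
open import Data.Bool using (Bool; true; false; not)
open import Data.Maybe using (Maybe; just; nothing)
open import Data.Vec using (Vec; lookup; foldr; _[_]%=_)
open import Data.Product using (Σ; ∃; _×_; _,_)
open import Data.Empty using (⊥)
open import Relation.Nullary using (¬_)
open import Relation.Unary using (Pred; _⊆_; _∈_)
open import Relation.Binary.PropositionalEquality using (_≡_; _≢_)
open import Relation.Binary.Construct.Closure.ReflexiveTransitive using (Star)

data Sign : Set where
  pos neg : Sign

_·_ : Sign → Sign → Sign
pos · s = s
neg · pos = neg
neg · neg = pos

-- A signed digraph on Fin n: E j i s  means  (j , i , s) ∈ E,
-- i.e. an arc from j to i of sign s.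
SignedDigraph : ℕ → Set₁
SignedDigraph n = Fin n → Fin n → Sign → Set

record Cycle {n : ℕ} (G : SignedDigraph n) : Set where
  field
    len     : ℕ
    verts   : Vec (Fin n) (suc len)
    signs   : Vec Sign (suc len)
    distinct : ∀ a b → lookup verts a ≡ lookup verts b → a ≡ b
    step    : ∀ (t : Fin len) →
              G (lookup verts (inject₁ t)) (lookup verts (suc t)) (lookup signs (inject₁ t))
    close   : G (lookup verts (fromℕ len)) (lookup verts zero) (lookup signs (fromℕ len))

cycleSign : ∀ {n} {G : SignedDigraph n} → Cycle G → Sign
cycleSign C = foldr _ _·_ pos (Cycle.signs C)

AllCyclesPositive : ∀ {n} → SignedDigraph n → Set
AllCyclesPositive G = ∀ (C : Cycle G) → cycleSign C ≡ pos

StronglyConnected : ∀ {n} → SignedDigraph n → Set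
StronglyConnected {n} G = ∀ (i j : Fin n) → Star (λ a b → ∃ λ s → G a b s) i j

Config : ℕ → Set
Config n = Vec Bool n

BN : ℕ → Set
BN n = Config n → Config n

flip : ∀ {n} → Config n → Fin n → Config n
flip x j = x [ j ]%= not

IG : ∀ {n} → BN n → SignedDigraph n
IG f j i pos = ∃ λ x → lookup x j ≡ false × lookup (f x) i ≡ false × lookup (f (flip x j)) i ≡ true
IG f j i neg = ∃ λ x → lookup x j ≡ false × lookup (f x) i ≡ true × lookup (f (flip x j)) i ≡ false

SpanningSubgraph : ∀ {n} → SignedDigraph n → SignedDigraph n → Set
SpanningSubgraph H G = ∀ j i s → H j i s → G j i s

STG : ℕ → Set₁
STG n = Config n → Config n → Set

Γ : ∀ {n} → BN n → STG n
Γ f x y = ∃ λ i → lookup (f x) i ≢ lookup x i × y ≡ flip x i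

UnionΓ : ∀ {n} → Pred (BN n) 0ℓ → STG n
UnionΓ F x y = ∃ λ f → f ∈ F × Γ f x y

CSet : ℕ → Set₁
CSet n = Pred (Config n) 0ℓ

NonEmpty : ∀ {n} → CSet n → Set
NonEmpty A = ∃ λ x → x ∈ A

TrapSet : ∀ {n} → STG n → CSet n → Set
TrapSet D A = ∀ x y → x ∈ A → D x y → y ∈ A

IsAttractor : ∀ {n} → STG n → CSet n → Set₁
IsAttractor D A =
  NonEmpty A × TrapSet D A ×
  (∀ (B : CSet _) → NonEmpty B → TrapSet D B → B ⊆ A → A ⊆ B)

-- subspaces: c i = just b fixes coordinate i to b, nothing leaves it free
Subspace : ∀ {n} → (Fin n → Maybe Bool) → CSet n
Subspace c x = ∀ i b → c i ≡ just b → lookup x i ≡ b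

span : ∀ {n} → CSet n → CSet n
span X x = ∀ c → X ⊆ Subspace c → x ∈ Subspace c

trapSpan : ∀ {n} → STG n → CSet n → CSet n
trapSpan D X x = ∀ c → TrapSet D (Subspace c) → X ⊆ Subspace c → x ∈ Subspace c

Trapping : ∀ {n} → STG n → Set₁
Trapping {n} D =
  (∀ (A B : CSet n) → IsAttractor D A → IsAttractor D B →
     ¬ (A ⊆ B × B ⊆ A) → ∀ x → ¬ (x ∈ span A × x ∈ span B)) ×
  (∀ (A : CSet n) → IsAttractor D A →
     span A ⊆ trapSpan D A × trapSpan D A ⊆ span A)

RobustlyTrapping : ∀ {n} → SignedDigraph n → Set₁
RobustlyTrapping {n} G =
  ∀ (F : Pred (BN n) 0ℓ) → (∃ λ f → f ∈ F) →
  (∀ f → f ∈ F → SpanningSubgraph (IG f) G) →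
  Trapping (UnionΓ F)

{-# OPTIONS --safe #-}
-- Since G is strongly connected and all its cycles are positive, every closed
-- walk is positive, so G is balanced: some σ : V → Sign satisfies
-- σ i = σ j · s for every arc (j, i, s). Every f with G(f) ⊆ G is then
-- monotone for the order ≤σ obtained by switching the coordinates with
-- σ i = neg. In the union of the asynchronous graphs of such networks, a
-- configuration m with m ≤σ f m for all f has a trap up-set, and descending
-- along ≤σ inside an attractor A reaches such an m; hence A has a least element
-- lo and, dually, a greatest element hi, and the interval [lo, hi] is a trap
-- space with [A] = [lo, hi] = ⟨A⟩. If the spans of two attractors meet, each
-- top lies below the other, so the attractors share a point and coincide.
module Submission where

open import Defs
open import Level using (0ℓ)
open import Data.Nat using (ℕ; zero; suc; _≤_; _<_; z≤n; s≤s)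
open import Data.Nat.Properties using (m≤n⇒m≤1+n; ≤-trans; ≤-refl)
open import Data.Fin using (Fin; zero; suc; inject₁; fromℕ; _≟_)
open import Data.Bool using (Bool; true; false; not; b≤b; f≤t)
  renaming (_≤_ to _≤ᵇ_)
open import Data.Bool.Properties as Bool
  using (not-involutive; ¬-not; ≤-minimum; ≤-maximum)
open import Data.Maybe using (Maybe; just; nothing)
open import Data.Vec using (Vec; []; _∷_; lookup; foldr)
open import Data.Vec.Properties
  using (lookup∘updateAt; lookup∘updateAt′; updateAt-updateAt; updateAt-id-local;
         tabulate∘lookup; tabulate-cong)
open import Data.Product using (Σ-syntax; ∃; _×_; _,_; proj₁; proj₂)
open import Data.Sum using (_⊎_; inj₁; inj₂)
open import Data.Empty using (⊥-elim)
open import Function using (_∘_)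
open import Function.Definitions using (Injective)
open import Relation.Nullary using (¬_; yes; no)
open import Relation.Nullary.Decidable using (decidable-stable)
open import Relation.Unary using (Pred; _⊆_; _∈_; _∉_)
open import Relation.Binary.PropositionalEquality
open import Relation.Binary.Construct.Closure.ReflexiveTransitive
  using (Star; ε; _◅_; _◅◅_; gmap; fold)

·-assoc : ∀ a b c → (a · b) · c ≡ a · (b · c)
·-assoc pos b c = refl
·-assoc neg pos c = refl
·-assoc neg neg pos = refl
·-assoc neg neg neg = refl

·-comm : ∀ a b → a · b ≡ b · a
·-comm pos pos = refl
·-comm pos neg = refl
·-comm neg pos = refl
·-comm neg neg = refl

·-identityʳ : ∀ a → a · pos ≡ a
·-identityʳ pos = refl
·-identityʳ neg = refl

x·yz≡y·xz : ∀ a b c → a · (b · c) ≡ b · (a · c)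
x·yz≡y·xz a b c = begin
  a · (b · c)  ≡⟨ ·-assoc a b c ⟨
  (a · b) · c  ≡⟨ cong (_· c) (·-comm a b) ⟩
  (b · a) · c  ≡⟨ ·-assoc b a c ⟩
  b · (a · c)  ∎
  where open ≡-Reasoning

·-inverse-unique : ∀ {a b} → a · b ≡ pos → a ≡ b
·-inverse-unique {pos} {pos} _ = refl
·-inverse-unique {neg} {neg} _ = refl
·-inverse-unique {pos} {neg} ()
·-inverse-unique {neg} {pos} ()

module _ {i t} {I : Set i} {T : I → I → Set t} where

  length : ∀ {a b} → Star T a b → ℕ
  length ε = 0
  length (_ ◅ w) = suc (length w)

  length-prefix : ∀ {a b c} (v : Star T a b) (w : Star T b c) → length v ≤ length (v ◅◅ w)
  length-prefix ε w = z≤n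
  length-prefix (_ ◅ v) w = s≤s (length-prefix v w)

  length-suffix : ∀ {a b c} (v : Star T a b) (w : Star T b c) → length w ≤ length (v ◅◅ w)
  length-suffix ε w = ≤-refl
  length-suffix (_ ◅ v) w = m≤n⇒m≤1+n (length-suffix v w)

  length-middle : ∀ {a b c d} (u : Star T a b) (v : Star T b c) (w : Star T c d) →
                  length v ≤ length (u ◅◅ v ◅◅ w)
  length-middle ε v w = length-prefix v w
  length-middle (_ ◅ u) v w = m≤n⇒m≤1+n (length-middle u v w)

  length-drop : ∀ {a b c d} (u : Star T a b) (x : T b c) (v : Star T c b) (w : Star T b d) →
                length (u ◅◅ w) < length (u ◅◅ (x ◅ v) ◅◅ w)
  length-drop ε x v w = s≤s (length-suffix v w)
  length-drop (_ ◅ u) x v w = s≤s (length-drop u x v w)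

lookup-∷-injective : ∀ {A : Set} {k} {x : A} {xs : Vec A k} →
                     (∀ p → lookup xs p ≢ x) → Injective _≡_ _≡_ (lookup xs) →
                     Injective _≡_ _≡_ (lookup (x ∷ xs))
lookup-∷-injective x∉xs inj {zero} {zero} _ = refl
lookup-∷-injective x∉xs inj {zero} {suc q} e = ⊥-elim (x∉xs q (sym e))
lookup-∷-injective x∉xs inj {suc p} {zero} e = ⊥-elim (x∉xs p e)
lookup-∷-injective x∉xs inj {suc p} {suc q} e = cong suc (inj e)

module Walks {n : ℕ} (G : SignedDigraph n) where

  Arc : Fin n → Fin n → Set
  Arc a b = ∃ λ s → G a b s

  Walk : Fin n → Fin n → Set
  Walk = Star Arc

  sign : ∀ {a b} → Walk a b → Sign
  sign ε = pos
  sign ((s , _) ◅ w) = s · sign w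

  sign-◅◅ : ∀ {a b c} (v : Walk a b) (w : Walk b c) → sign (v ◅◅ w) ≡ sign v · sign w
  sign-◅◅ ε w = refl
  sign-◅◅ ((s , _) ◅ v) w =
    trans (cong (s ·_) (sign-◅◅ v w)) (sym (·-assoc s (sign v) (sign w)))

  vertices : ∀ {a b} (w : Walk a b) → Vec (Fin n) (suc (length w))
  vertices {a} ε = a ∷ []
  vertices {a} (_ ◅ w) = a ∷ vertices w

  arcSigns : ∀ {a b} (w : Walk a b) → Sign → Vec Sign (suc (length w))
  arcSigns ε s = s ∷ []
  arcSigns ((t , _) ◅ w) s = t ∷ arcSigns w s

  module _ {a b s} (e : G a b s) (w : Walk b a) (distinct : Injective _≡_ _≡_ (lookup (vertices w))) where

    private
      first-vertex : ∀ {c} (v : Walk c a) → lookup (vertices v) zero ≡ c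
      first-vertex ε = refl
      first-vertex (_ ◅ v) = refl

      last-vertex : ∀ {c} (v : Walk c a) → lookup (vertices v) (fromℕ (length v)) ≡ a
      last-vertex ε = refl
      last-vertex (_ ◅ v) = last-vertex v

      last-sign : ∀ {c} (v : Walk c a) → lookup (arcSigns v s) (fromℕ (length v)) ≡ s
      last-sign ε = refl
      last-sign (_ ◅ v) = last-sign v

      step : ∀ {c} (v : Walk c a) (p : Fin (length v)) →
             G (lookup (vertices v) (inject₁ p)) (lookup (vertices v) (suc p))
               (lookup (arcSigns v s) (inject₁ p))
      step ((_ , x) ◅ ε) zero = x
      step ((_ , x) ◅ (y ◅ v)) zero = x
      step (_ ◅ v) (suc p) = step v p

    cycle : Cycle G
    cycle = record
      { len = length w
      ; verts = vertices w
      ; signs = arcSigns w s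
      ; distinct = λ p q → distinct
      ; step = step w
      ; close = subst (λ c → G (lookup (vertices w) (fromℕ (length w))) c
                                (lookup (arcSigns w s) (fromℕ (length w))))
                  (sym (first-vertex w))
                  (subst₂ (λ c t → G c b t) (sym (last-vertex w)) (sym (last-sign w)) e)
      }

    cycleSign-cycle : cycleSign cycle ≡ sign w · s
    cycleSign-cycle = go w
      where
        go : ∀ {c} (v : Walk c a) → foldr _ _·_ pos (arcSigns v s) ≡ sign v · s
        go ε = ·-identityʳ s
        go ((t , _) ◅ v) = trans (cong (t ·_) (go v)) (sym (·-assoc t (sign v) s))

  split : ∀ {a b} v (w : Walk a b) →
          (Σ[ u ∈ Walk a v ] Σ[ u′ ∈ Walk v b ] w ≡ u ◅◅ u′) ⊎ (∀ p → lookup (vertices w) p ≢ v)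
  split {a} v w with a ≟ v
  split v w | yes refl = inj₁ (ε , w , refl)
  split v ε | no a≢v = inj₂ λ { zero → a≢v }
  split v (x ◅ w) | no a≢v with split v w
  ... | inj₁ (u , u′ , refl) = inj₁ (x ◅ u , u′ , refl)
  ... | inj₂ v∉w = inj₂ λ { zero → a≢v ; (suc p) → v∉w p }

  record Loop {a b} (w : Walk a b) : Set where
    constructor loop
    field
      {v u} : Fin n
      prefix : Walk a v
      arc : Arc v u
      back : Walk u v
      suffix : Walk v b
      decomposition : w ≡ prefix ◅◅ (arc ◅ back) ◅◅ suffix

  distinct-or-loop : ∀ {a b} (w : Walk a b) → Injective _≡_ _≡_ (lookup (vertices w)) ⊎ Loop w
  distinct-or-loop ε = inj₁ λ { {zero} {zero} _ → refl }
  distinct-or-loop {a} (x ◅ w) with split a w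
  ... | inj₁ (u , u′ , refl) = inj₂ (loop ε x u u′ refl)
  ... | inj₂ a∉w with distinct-or-loop w
  ...   | inj₁ distinct = inj₁ (lookup-∷-injective a∉w distinct)
  ...   | inj₂ (loop p y l q refl) = inj₂ (loop (x ◅ p) y l q refl)

  -- A closed walk with a repeated vertex splits into two shorter closed walks.
  closedWalk-positive : AllCyclesPositive G → ∀ {a} (w : Walk a a) → sign w ≡ pos
  closedWalk-positive positive w = bounded (length w) w ≤-refl
    where
      bounded : ∀ N {a} (w : Walk a a) → length w ≤ N → sign w ≡ pos
      bounded N ε _ = refl
      bounded (suc N) ((s , e) ◅ w) (s≤s |w|≤N) with distinct-or-loop w
      ... | inj₁ distinct = begin
        s · sign w  ≡⟨ ·-comm s (sign w) ⟩
        sign w · s  ≡⟨ cycleSign-cycle e w distinct ⟨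
        cycleSign (cycle e w distinct)  ≡⟨ positive (cycle e w distinct) ⟩
        pos  ∎
        where open ≡-Reasoning
      ... | inj₂ (loop p x l q refl) = begin
        s · sign (p ◅◅ (x ◅ l) ◅◅ q)          ≡⟨ cong (s ·_) (trans (sign-◅◅ p _) (cong (sign p ·_) (sign-◅◅ (x ◅ l) q))) ⟩
        s · (sign p · (sign (x ◅ l) · sign q)) ≡⟨ cong (s ·_) (x·yz≡y·xz (sign p) (sign (x ◅ l)) (sign q)) ⟩
        s · (sign (x ◅ l) · (sign p · sign q)) ≡⟨ x·yz≡y·xz s (sign (x ◅ l)) (sign p · sign q) ⟩
        sign (x ◅ l) · (s · (sign p · sign q)) ≡⟨ cong₂ _·_ loop-positive (trans (cong (s ·_) (sym (sign-◅◅ p q))) rest-positive) ⟩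
        pos  ∎
        where
          open ≡-Reasoning
          loop-positive : sign (x ◅ l) ≡ pos
          loop-positive = bounded N (x ◅ l) (≤-trans (length-middle p (x ◅ l) q) |w|≤N)
          rest-positive : sign ((s , e) ◅ (p ◅◅ q)) ≡ pos
          rest-positive = bounded N ((s , e) ◅ (p ◅◅ q)) (≤-trans (length-drop p x l q) |w|≤N)

SignBalanced : ∀ {n} → SignedDigraph n → (Fin n → Sign) → Set
SignBalanced G σ = ∀ {j i s} → G j i s → σ i ≡ σ j · s

balanced-switching : ∀ {n} (G : SignedDigraph n) →
                     StronglyConnected G → AllCyclesPositive G → ∃ (SignBalanced G)
balanced-switching {zero} G _ _ = (λ ()) , λ { {()} }
balanced-switching {suc n} G connected positive = σ , balanced
  where
    open Walks G

    σ : Fin (suc n) → Sign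
    σ v = sign (connected zero v)

    -- Both σ i and σ j · s are inverse to the sign of a fixed walk i ⇝ zero.
    balanced : SignBalanced G σ
    balanced {j} {i} {s} e = trans (·-inverse-unique via-i) (sym (·-inverse-unique via-j))
      where
        back = connected i zero
        via-i : σ i · sign back ≡ pos
        via-i = trans (sym (sign-◅◅ (connected zero i) back))
                      (closedWalk-positive positive (connected zero i ◅◅ back))
        via-j : (σ j · s) · sign back ≡ pos
        via-j = trans (·-assoc (σ j) s (sign back))
                  (trans (sym (sign-◅◅ (connected zero j) ((s , e) ◅ back)))
                         (closedWalk-positive positive (connected zero j ◅◅ (s , e) ◅ back)))

lookup-flip : ∀ {n} (x : Config n) j → lookup (flip x j) j ≡ not (lookup x j)
lookup-flip x j = lookup∘updateAt j x

lookup-flip-other : ∀ {n} (x : Config n) {i j} → i ≢ j → lookup (flip x j) i ≡ lookup x i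
lookup-flip-other x {i} {j} i≢j = lookup∘updateAt′ i j i≢j x

flip-involutive : ∀ {n} (x : Config n) j → flip (flip x j) j ≡ x
flip-involutive x j =
  trans (updateAt-updateAt j x) (updateAt-id-local j x (not-involutive (lookup x j)))

Config-ext : ∀ {n} {x y : Config n} → (∀ i → lookup x i ≡ lookup y i) → x ≡ y
Config-ext {x = x} {y} same =
  trans (sym (tabulate∘lookup x)) (trans (tabulate-cong same) (tabulate∘lookup y))

switch : Sign → Bool → Bool
switch pos b = b
switch neg b = not b

switch-not : ∀ s b → switch s (not b) ≡ not (switch s b)
switch-not pos b = refl
switch-not neg b = refl

switch-involutive : ∀ s b → switch s (switch s b) ≡ b
switch-involutive pos b = refl
switch-involutive neg b = not-involutive b

switch-· : ∀ s t b → switch (s · t) b ≡ switch s (switch t b)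
switch-· pos t b = refl
switch-· neg pos b = refl
switch-· neg neg b = sym (not-involutive b)

switch-injective : ∀ s {a b} → switch s a ≡ switch s b → a ≡ b
switch-injective s {a} {b} e =
  trans (sym (switch-involutive s a)) (trans (cong (switch s) e) (switch-involutive s b))

≤-switch-step : ∀ s {a b} → switch s a ≤ᵇ switch s b → a ≡ b ⊎ (switch s a ≡ false × b ≡ not a)
≤-switch-step pos {false} {false} _ = inj₁ refl
≤-switch-step pos {false} {true} _ = inj₂ (refl , refl)
≤-switch-step pos {true} {true} _ = inj₁ refl
≤-switch-step neg {false} {false} _ = inj₁ refl
≤-switch-step neg {true} {false} _ = inj₂ (refl , refl)
≤-switch-step neg {true} {true} _ = inj₁ refl
≤-switch-step pos {true} {false} ()
≤-switch-step neg {false} {true} ()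

not-antitone : ∀ {a b} → a ≤ᵇ b → not b ≤ᵇ not a
not-antitone b≤b = b≤b
not-antitone f≤t = f≤t

infix 4 _≤[_]_

record _≤[_]_ {n} (x : Config n) (σ : Fin n → Sign) (y : Config n) : Set where
  constructor mk≤
  field
    ≤-at : ∀ i → switch (σ i) (lookup x i) ≤ᵇ switch (σ i) (lookup y i)

open _≤[_]_

module _ {n} {σ : Fin n → Sign} where

  ≤-reflexive : ∀ {x} → x ≤[ σ ] x
  ≤-reflexive = mk≤ λ i → b≤b

  ≤-transitive : ∀ {x y z} → x ≤[ σ ] y → y ≤[ σ ] z → x ≤[ σ ] z
  ≤-transitive x≤y y≤z = mk≤ λ i → Bool.≤-trans (≤-at x≤y i) (≤-at y≤z i)

  ≤-antisymmetric : ∀ {x y} → x ≤[ σ ] y → y ≤[ σ ] x → x ≡ y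
  ≤-antisymmetric x≤y y≤x = Config-ext λ i → switch-injective (σ i) (Bool.≤-antisym (≤-at x≤y i) (≤-at y≤x i))

opposite : ∀ {n} → (Fin n → Sign) → Fin n → Sign
opposite σ i = neg · σ i

module _ {n} (σ : Fin n → Sign) {x y : Config n} where

  ≤-opposite⁺ : y ≤[ σ ] x → x ≤[ opposite σ ] y
  ≤-opposite⁺ y≤x = mk≤ λ i → subst₂ _≤ᵇ_ (sym (switch-· neg (σ i) _)) (sym (switch-· neg (σ i) _))
                        (not-antitone (≤-at y≤x i))

  ≤-opposite⁻ : x ≤[ opposite σ ] y → y ≤[ σ ] x
  ≤-opposite⁻ x≤y = mk≤ λ i → subst₂ _≤ᵇ_ (not-involutive _) (not-involutive _)
                        (not-antitone (subst₂ _≤ᵇ_ (switch-· neg (σ i) _) (switch-· neg (σ i) _) (≤-at x≤y i)))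

Monotone : ∀ {n} → (Fin n → Sign) → BN n → Set
Monotone σ f = ∀ {x y} → x ≤[ σ ] y → f x ≤[ σ ] f y

monotone-opposite : ∀ {n} (σ : Fin n → Sign) (f : BN n) → Monotone σ f → Monotone (opposite σ) f
monotone-opposite σ f mono x≤y = ≤-opposite⁺ σ (mono (≤-opposite⁻ σ x≤y))

UpFlip : ∀ {n} → (Fin n → Sign) → Config n → Config n → Set
UpFlip σ x y = ∃ λ j → switch (σ j) (lookup x j) ≡ false × y ≡ flip x j

≤⇒upFlips : ∀ {n} (σ : Fin n → Sign) {x y : Config n} → x ≤[ σ ] y → Star (UpFlip σ) x y
≤⇒upFlips σ {[]} {[]} _ = ε
≤⇒upFlips σ {a ∷ x} {b ∷ y} a∷x≤b∷y =
  gmap (a ∷_) tail-step (≤⇒upFlips (σ ∘ suc) (mk≤ (≤-at a∷x≤b∷y ∘ suc)))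
  ◅◅ head-steps (≤-switch-step (σ zero) (≤-at a∷x≤b∷y zero))
  where
    tail-step : ∀ {x′ y′} → UpFlip (σ ∘ suc) x′ y′ → UpFlip σ (a ∷ x′) (a ∷ y′)
    tail-step (j , low , refl) = suc j , low , refl
    head-steps : ∀ {c} → a ≡ c ⊎ (switch (σ zero) a ≡ false × c ≡ not a) →
                 Star (UpFlip σ) (a ∷ y) (c ∷ y)
    head-steps (inj₁ refl) = ε
    head-steps (inj₂ (low , refl)) = (zero , low , refl) ◅ ε

downFlip-induction : ∀ {n} (σ : Fin n → Sign) (P : Config n → Set) →
  (∀ x → (∀ i → switch (σ i) (lookup x i) ≡ true → P (flip x i)) → P x) → ∀ x → P x
downFlip-induction σ P step [] = step [] λ ()
downFlip-induction {suc n} σ P step (a ∷ x) = from-any a x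
  where
    from-low : ∀ a → switch (σ zero) a ≡ false → ∀ x → P (a ∷ x)
    from-low a low = downFlip-induction (σ ∘ suc) (λ x → P (a ∷ x)) λ x ih →
      step (a ∷ x) λ { zero high → ⊥-elim (Bool.not-¬ low high) ; (suc i) high → ih i high }
    from-any : ∀ a x → P (a ∷ x)
    from-any a with switch (σ zero) a in e
    ... | false = from-low a e
    ... | true = downFlip-induction (σ ∘ suc) (λ x → P (a ∷ x)) λ x ih →
      step (a ∷ x) λ { zero _ → from-low (not a) (trans (switch-not (σ zero) a) (cong not e)) x
                     ; (suc i) high → ih i high }

IG-arc : ∀ {n} (f : BN n) x j i → lookup (f x) i ≢ lookup (f (flip x j)) i →
         ∃ λ s → switch s (lookup x j) ≡ lookup (f x) i × IG f j i s
IG-arc f x j i differ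
  with lookup x j in xj | lookup (f x) i in fx | lookup (f (flip x j)) i in fy
... | false | false | true = pos , refl , x , xj , fx , fy
... | false | true | false = neg , refl , x , xj , fx , fy
... | true | true | false =
  pos , refl , flip x j , trans (lookup-flip x j) (cong not xj) , fy ,
  trans (cong (λ z → lookup (f z) i) (flip-involutive x j)) fx
... | true | false | true =
  neg , refl , flip x j , trans (lookup-flip x j) (cong not xj) , fy ,
  trans (cong (λ z → lookup (f z) i) (flip-involutive x j)) fx
... | _ | false | false = ⊥-elim (differ refl)
... | _ | true | true = ⊥-elim (differ refl)

module _ {n} {G : SignedDigraph n} {σ : Fin n → Sign} (balanced : SignBalanced G σ)
         {f : BN n} (f⊆G : SpanningSubgraph (IG f) G) where

  -- If coordinate i changes, balance along the arc j → i of G(f) forces switch (σ i) (f x i) = false.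
  upFlip-monotone : ∀ x j → switch (σ j) (lookup x j) ≡ false → f x ≤[ σ ] f (flip x j)
  upFlip-monotone x j low .≤-at i with lookup (f x) i Bool.≟ lookup (f (flip x j)) i
  ... | yes same = Bool.≤-reflexive (cong (switch (σ i)) same)
  ... | no differ with IG-arc f x j i differ
  ...   | s , agrees , arc = subst (_≤ᵇ switch (σ i) (lookup (f (flip x j)) i)) (sym drops) (≤-minimum _)
    where
      open ≡-Reasoning
      drops : switch (σ i) (lookup (f x) i) ≡ false
      drops = begin
        switch (σ i) (lookup (f x) i)             ≡⟨ cong (λ t → switch t _) (balanced (f⊆G j i s arc)) ⟩
        switch (σ j · s) (lookup (f x) i)         ≡⟨ switch-· (σ j) s _ ⟩
        switch (σ j) (switch s (lookup (f x) i))  ≡⟨ cong (switch (σ j) ∘ switch s) agrees ⟨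
        switch (σ j) (switch s (switch s (lookup x j))) ≡⟨ cong (switch (σ j)) (switch-involutive s _) ⟩
        switch (σ j) (lookup x j)                 ≡⟨ low ⟩
        false  ∎

  balanced⇒monotone : Monotone σ f
  balanced⇒monotone x≤y =
    fold (λ x y → f x ≤[ σ ] f y)
         (λ { (j , low , refl) rest → ≤-transitive (upFlip-monotone _ j low) rest })
         ≤-reflexive (≤⇒upFlips σ x≤y)

attractor-⊆-trapSet : ∀ {n} {D : STG n} {A T : CSet n} → IsAttractor D A → TrapSet D T →
                      ∀ {x} → x ∈ A → x ∈ T → A ⊆ T
attractor-⊆-trapSet {A = A} {T} (_ , trapA , minimal) trapT {x} x∈A x∈T y∈A =
  proj₂ (minimal (λ y → y ∈ A × y ∈ T) (x , x∈A , x∈T)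
           (λ y z (y∈A , y∈T) step → trapA y z y∈A step , trapT y z y∈T step)
           proj₁ y∈A)

module Dynamics {n} (F : Pred (BN n) 0ℓ) (σ : Fin n → Sign)
                (monotone : ∀ f → f ∈ F → Monotone σ f) where

  D : STG n
  D = UnionΓ F

  ↑_ : Config n → CSet n
  ↑ m = m ≤[ σ ]_

  ↑-trapSet : ∀ {m} → (∀ f → f ∈ F → m ≤[ σ ] f m) → TrapSet D (↑ m)
  ↑-trapSet {m} m≤fm y _ m≤y (f , f∈F , k , moves , refl) .≤-at i with i ≟ k
  ... | yes refl rewrite lookup-flip y i | sym (¬-not moves) =
        Bool.≤-trans (≤-at (m≤fm f f∈F) i) (≤-at (monotone f f∈F m≤y) i)
  ... | no i≢k rewrite lookup-flip-other y i≢k = ≤-at m≤y i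

  Bottom : CSet n → Config n → Set
  Bottom A m = m ∈ A × A ⊆ ↑ m × TrapSet D (↑ m)

  -- Descending along ≤σ inside A stops at some y with y ≤σ f y for all f ∈ F.
  bottom : ∀ {A} → IsAttractor D A → ¬ ¬ ∃ (Bottom A)
  bottom {A} att@((x , x∈A) , trap , _) noBottom =
    downFlip-induction σ (_∉ A) descend x x∈A
    where
      descend : ∀ y → (∀ i → switch (σ i) (lookup y i) ≡ true → flip y i ∉ A) → y ∉ A
      descend y noDrop y∈A = noBottom (y , y∈A , attractor-⊆-trapSet att ↑y-trap y∈A ≤-reflexive , ↑y-trap)
        where
          y≤fy : ∀ f → f ∈ F → y ≤[ σ ] f y
          y≤fy f f∈F .≤-at i with lookup (f y) i Bool.≟ lookup y i
          ... | yes same = Bool.≤-reflexive (cong (switch (σ i)) (sym same))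
          ... | no moves with switch (σ i) (lookup y i) in e
          ...   | false = ≤-minimum _
          ...   | true = ⊥-elim (noDrop i e (trap y (flip y i) y∈A (f , f∈F , i , moves , refl)))
          ↑y-trap : TrapSet D (↑ y)
          ↑y-trap = ↑-trapSet y≤fy

agree : Bool → Bool → Maybe Bool
agree false false = just false
agree true true = just true
agree _ _ = nothing

agree-diagonal : ∀ b → agree b b ≡ just b
agree-diagonal false = refl
agree-diagonal true = refl

agree-within : ∀ s {a b c d} → agree a b ≡ just d →
               switch s a ≤ᵇ switch s c → switch s c ≤ᵇ switch s b → c ≡ d
agree-within s {false} {false} refl a≤c c≤b = switch-injective s (Bool.≤-antisym c≤b a≤c)
agree-within s {true} {true} refl a≤c c≤b = switch-injective s (Bool.≤-antisym c≤b a≤c)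
agree-within s {false} {true} () a≤c c≤b
agree-within s {true} {false} () a≤c c≤b

agree-bounds : ∀ s {a b c} → switch s a ≤ᵇ switch s b → (∀ d → agree a b ≡ just d → c ≡ d) →
               switch s a ≤ᵇ switch s c × switch s c ≤ᵇ switch s b
agree-bounds s {false} {false} _ fixed rewrite fixed false refl = b≤b , b≤b
agree-bounds s {true} {true} _ fixed rewrite fixed true refl = b≤b , b≤b
agree-bounds pos {false} {true} _ _ = ≤-minimum _ , ≤-maximum _
agree-bounds neg {true} {false} _ _ = ≤-minimum _ , ≤-maximum _
agree-bounds pos {true} {false} () _
agree-bounds neg {false} {true} () _

module _ {n} {σ : Fin n → Sign} {lo hi : Config n} where

  Interval : CSet n
  Interval y = lo ≤[ σ ] y × y ≤[ σ ] hi

  Interval⊆Subspace : Interval ⊆ Subspace (λ k → agree (lookup lo k) (lookup hi k))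
  Interval⊆Subspace (lo≤y , y≤hi) i b fixed = agree-within (σ i) fixed (≤-at lo≤y i) (≤-at y≤hi i)

  Subspace⊆Interval : lo ≤[ σ ] hi → Subspace (λ k → agree (lookup lo k) (lookup hi k)) ⊆ Interval
  Subspace⊆Interval lo≤hi y∈S =
    mk≤ (λ i → proj₁ (agree-bounds (σ i) (≤-at lo≤hi i) (y∈S i))) ,
    mk≤ (λ i → proj₂ (agree-bounds (σ i) (≤-at lo≤hi i) (y∈S i)))

module MonotoneUnion {n} (F : Pred (BN n) 0ℓ) (σ : Fin n → Sign)
                     (monotone : ∀ f → f ∈ F → Monotone σ f) where

  module Up = Dynamics F σ monotone
  open Up using (D)
  module Down = Dynamics F (opposite σ) (λ f f∈F → monotone-opposite σ f (monotone f f∈F))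

  record Hull (A : CSet n) : Set where
    field
      lo hi : Config n
      lo∈A : lo ∈ A
      hi∈A : hi ∈ A
      A⊆Interval : A ⊆ Interval {σ = σ} {lo} {hi}
      ↑lo-trapSet : TrapSet D (lo ≤[ σ ]_)
      ↓hi-trapSet : TrapSet D (_≤[ σ ] hi)

    hull-subspace : Fin n → Maybe Bool
    hull-subspace k = agree (lookup lo k) (lookup hi k)

    A⊆hull-subspace : A ⊆ Subspace hull-subspace
    A⊆hull-subspace = Interval⊆Subspace ∘ A⊆Interval

    hull-subspace⊆Interval : Subspace hull-subspace ⊆ Interval {σ = σ} {lo} {hi}
    hull-subspace⊆Interval = Subspace⊆Interval (proj₁ (A⊆Interval hi∈A))

    span⊆Interval : span A ⊆ Interval {σ = σ} {lo} {hi}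
    span⊆Interval x∈[A] = hull-subspace⊆Interval (x∈[A] hull-subspace A⊆hull-subspace)

    hull-trapSpace : TrapSet D (Subspace hull-subspace)
    hull-trapSpace y z y∈S step with hull-subspace⊆Interval y∈S
    ... | lo≤y , y≤hi = Interval⊆Subspace (↑lo-trapSet y z lo≤y step , ↓hi-trapSet y z y≤hi step)

  open Hull

  hull : ∀ {A} → IsAttractor D A → ¬ ¬ Hull A
  hull att noHull =
    Up.bottom att λ (lo , lo∈A , A⊆↑lo , ↑lo-trap) →
    Down.bottom att λ (hi , hi∈A , A⊆↓hi , ↓hi-trap) →
    noHull record
      { lo = lo ; hi = hi ; lo∈A = lo∈A ; hi∈A = hi∈A
      ; A⊆Interval = λ y∈A → A⊆↑lo y∈A , ≤-opposite⁻ σ (A⊆↓hi y∈A)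
      ; ↑lo-trapSet = ↑lo-trap
      ; ↓hi-trapSet = λ y z y≤hi step → ≤-opposite⁻ σ (↓hi-trap y z (≤-opposite⁺ σ y≤hi) step)
      }

  hi-below : ∀ {A B} x → IsAttractor D A → (hA : Hull A) (hB : Hull B) →
             x ∈ span A → x ∈ span B → hi hA ≤[ σ ] hi hB
  hi-below x att hA hB x∈[A] x∈[B] =
    attractor-⊆-trapSet att (↓hi-trapSet hB) (lo∈A hA)
      (≤-transitive (proj₁ (span⊆Interval hA {x} x∈[A])) (proj₂ (span⊆Interval hB {x} x∈[B])))
      (hi∈A hA)

  spans-disjoint : ∀ {A B} → IsAttractor D A → IsAttractor D B →
                   ¬ (A ⊆ B × B ⊆ A) → ∀ x → ¬ (x ∈ span A × x ∈ span B)
  spans-disjoint {A} {B} attA attB A≢B x (x∈[A] , x∈[B]) =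
    hull attA λ hA → hull attB λ hB →
      let hiA≡hiB = ≤-antisymmetric (hi-below x attA hA hB x∈[A] x∈[B])
                                    (hi-below x attB hB hA x∈[B] x∈[A])
      in A≢B ( attractor-⊆-trapSet attA (proj₁ (proj₂ attB)) (hi∈A hA)
                 (subst (_∈ B) (sym hiA≡hiB) (hi∈A hB))
             , attractor-⊆-trapSet attB (proj₁ (proj₂ attA)) (hi∈A hB)
                 (subst (_∈ A) hiA≡hiB (hi∈A hA)) )

  trapSpan⊆span : ∀ {A} → IsAttractor D A → trapSpan D A ⊆ span A
  trapSpan⊆span att {x} x∈⟨A⟩ c A⊆c i b fixed =
    decidable-stable (lookup x i Bool.≟ b) λ x≢b → hull att λ h →
      x≢b (x∈⟨A⟩ (hull-subspace h) (hull-trapSpace h) (A⊆hull-subspace h) i b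
             (trans (cong₂ agree (A⊆c (lo∈A h) i b fixed) (A⊆c (hi∈A h) i b fixed))
                    (agree-diagonal b)))

  trapping : Trapping D
  trapping = (λ A B → spans-disjoint {A} {B})
           , λ A att → (λ x∈[A] c _ A⊆c → x∈[A] c A⊆c) , λ {x} → trapSpan⊆span {A} att {x}

lemma18 : ∀ (n : ℕ) (G : SignedDigraph n) →
    StronglyConnected G → AllCyclesPositive G → RobustlyTrapping G
lemma18 n G connected positive F _ F⊆G with balanced-switching G connected positive
... | σ , balanced =
  MonotoneUnion.trapping F σ λ f f∈F → balanced⇒monotone balanced (F⊆G f f∈F)
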